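{- Let $G=(V^+,V^-;E)$ be a bipartite graph with $|V^+|=|V^-|=n\ge2$ and $|E|=2n$. Then $G$ is minimally DM-irreducible if and only if both of the following hold: - $G$ is connected; - $|\Gamma_G(\{v\})|=2$ for every vertex $v\in V^+\cup V^-$. Equivalently, ignoring edge directions, $G$ is a Hamiltonian cycle on $V^+\cup V^-$.
   Context: A bipartite graph $G=(V^+,V^-;E)$ has finite disjoint vertex sides $V^+,V^-$, and its edge set satisfies $E\subseteq V^+\times V^-$ (no parallel edges). For a vertex $v$, $\Gamma_G(\{v\})$ is the set of vertices on the other side adjacent to $v$. For $X\subseteq V^+$, $\Gamma_G(X)$ is the set of vertices of $V^-$ adjacent to some vertex of $X$. DM-decomposition. Define $f_G(X)=|\Gamma_G(X)|-|X|$ for $X\subseteq V^+$. Its minimizers form a lattice under union and intersection. Take a maximal chain $X_0\subsetneq\cdots\subsetneq X_k$ of minimizers and set: - $V_0=X_0\cup\Gamma_G(X_0)$; - $V_i=(X_i\setminus X_{i-1})\cup(\Gamma_G(X_i)\setminus\Gamma_G(X_{i-1}))$ for $i=1,\dots,k$; - $V_\infty=(V^+\setminus X_k)\cup(V^-\setminus\Gamma_G(X_k))$. This partition of $V=V^+\cup V^-$ is independent of the chain. $G$ is DM-irreducible if exactly one part is nonempty, i.e. $V_0=V$, or $V_1=V$, or $V_\infty=V$. $G$ is minimally DM-irreducible if $G$ is DM-irreducible but $(V^+,V^-;E\setminus\{e\})$ is not DM-irreducible for every $e\in E$. -}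

module Defs where

open import Data.Nat using (ℕ; zero; suc; _+_)
open import Data.Bool using (Bool; true; false; _∧_; _∨_; if_then_else_)
open import Data.Fin using (Fin; zero; suc; _≟_)
open import Data.Fin.Subset using (Subset; ∣_∣; _⊆_; _⊂_; _─_; _∪_)
  renaming (⊤ to Full; ⊥ to Empty)
open import Data.Vec using (Vec; tabulate; lookup)
open import Data.List using (List; []; _∷_)
open import Data.List.Membership.Propositional using (_∈_)
open import Data.List.Relation.Unary.All using (All)
open import Data.Integer using (ℤ; +_; _-_; _≤_)
open import Data.Product using (Σ; _×_; ∃; ∃-syntax)
open import Data.Sum using (_⊎_; inj₁; inj₂)
open import Data.Unit using (⊤)
open import Relation.Nullary using (¬_)
open import Relation.Nullary.Decidable using (⌊_⌋)
open import Relation.Binary.PropositionalEquality using (_≡_)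
open import Relation.Binary.Construct.Closure.ReflexiveTransitive using (Star)
open import Function using (flip)

-- A bipartite graph with V⁺ = Fin n, V⁻ = Fin n (|V⁺| = |V⁻| = n),
-- given by its edge set E ⊆ V⁺ × V⁻ as a Boolean adjacency relation
-- (G i j ≡ true  iff  (i , j) ∈ E).  No parallel edges by construction.
Graph : ℕ → Set
Graph n = Fin n → Fin n → Bool

anyFin : ∀ {n} → (Fin n → Bool) → Bool
anyFin {zero}  f = false
anyFin {suc n} f = f zero ∨ anyFin (λ i → f (suc i))

countFin : ∀ {n} → (Fin n → Bool) → ℕ
countFin {zero}  f = 0
countFin {suc n} f = (if f zero then 1 else 0) + countFin (λ i → f (suc i))

sumFin : ∀ {n} → (Fin n → ℕ) → ℕ
sumFin {zero}  f = 0
sumFin {suc n} f = f zero + sumFin (λ i → f (suc i))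

edgeCount : ∀ {n} → Graph n → ℕ
edgeCount G = sumFin (λ i → countFin (G i))

-- Γ_G(X) ⊆ V⁻ for X ⊆ V⁺
Γ : ∀ {n} → Graph n → Subset n → Subset n
Γ G X = tabulate (λ j → anyFin (λ i → lookup X i ∧ G i j))

-- The same graph viewed from the V⁻ side (Γ of a subset of V⁻ is a subset of V⁺).
transpose : ∀ {n} → Graph n → Graph n
transpose G = flip G

Vertex : ℕ → Set
Vertex n = Fin n ⊎ Fin n

degree : ∀ {n} → Graph n → Vertex n → ℕ
degree G (inj₁ i) = ∣ Γ G (Data.Fin.Subset.⁅ i ⁆) ∣
degree G (inj₂ j) = ∣ Γ (transpose G) (Data.Fin.Subset.⁅ j ⁆) ∣

data Adj {n} (G : Graph n) : Vertex n → Vertex n → Set where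
  plus→minus : ∀ {i j} → G i j ≡ true → Adj G (inj₁ i) (inj₂ j)
  minus→plus : ∀ {i j} → G i j ≡ true → Adj G (inj₂ j) (inj₁ i)

Connected : ∀ {n} → Graph n → Set
Connected G = ∀ u v → Star (Adj G) u v

f : ∀ {n} → Graph n → Subset n → ℤ
f G X = + ∣ Γ G X ∣ - + ∣ X ∣

Minimizer : ∀ {n} → Graph n → Subset n → Set
Minimizer G X = ∀ Y → f G X ≤ f G Y

-- A chain X₀ ⊊ X₁ ⊊ … ⊊ X_k is represented by X₀ and the list [X₁ , … , X_k].
StrictlyIncreasing : ∀ {n} → Subset n → List (Subset n) → Set
StrictlyIncreasing X []       = ⊤
StrictlyIncreasing X (Y ∷ Ys) = X ⊂ Y × StrictlyIncreasing Y Ys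

lastOf : ∀ {n} → Subset n → List (Subset n) → Subset n
lastOf X []       = X
lastOf X (Y ∷ Ys) = lastOf Y Ys

MaximalMinimizerChain : ∀ {n} → Graph n → Subset n → List (Subset n) → Set
MaximalMinimizerChain G X₀ Xs =
  StrictlyIncreasing X₀ Xs
  × All (Minimizer G) (X₀ ∷ Xs)
  × (∀ Y → Minimizer G Y → All (λ X → Y ⊆ X ⊎ X ⊆ Y) (X₀ ∷ Xs) → Y ∈ (X₀ ∷ Xs))

-- DM-decomposition parts (each part is a pair: its V⁺-part and its V⁻-part).
-- V₀ = X₀ ∪ Γ(X₀)
V₀ : ∀ {n} → Graph n → Subset n → List (Subset n) → Subset n × Subset n
V₀ G X₀ Xs = X₀ Data.Product., Γ G X₀

V∞ : ∀ {n} → Graph n → Subset n → List (Subset n) → Subset n × Subset n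
V∞ G X₀ Xs = (Full ─ lastOf X₀ Xs) Data.Product., (Full ─ Γ G (lastOf X₀ Xs))

-- "V₁ = V": the chain has k ≥ 1 and V₁ = (X₁ ∖ X₀) ∪ (Γ(X₁) ∖ Γ(X₀)) is all of V.
V₁IsAll : ∀ {n} → Graph n → Subset n → List (Subset n) → Set
V₁IsAll G X₀ []        = Data.Empty.⊥
  where import Data.Empty
V₁IsAll G X₀ (X₁ ∷ Xs) = (X₁ ─ X₀) ≡ Full × (Γ G X₁ ─ Γ G X₀) ≡ Full

-- DM-irreducible: for (some, equivalently every) maximal chain of minimizers,
-- V₀ = V or V₁ = V or V_∞ = V.
DMIrreducible : ∀ {n} → Graph n → Set
DMIrreducible {n} G =
  Σ (Subset n) λ X₀ → Σ (List (Subset n)) λ Xs →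
    MaximalMinimizerChain G X₀ Xs ×
    (V₀ G X₀ Xs ≡ (Full Data.Product., Full)
     ⊎ V₁IsAll G X₀ Xs
     ⊎ V∞ G X₀ Xs ≡ (Full Data.Product., Full))

deleteEdge : ∀ {n} → Graph n → Fin n → Fin n → Graph n
deleteEdge G a b i j = if ⌊ i ≟ a ⌋ ∧ ⌊ j ≟ b ⌋ then false else G i j

MinimallyDMIrreducible : ∀ {n} → Graph n → Set
MinimallyDMIrreducible G =
  DMIrreducible G × (∀ a b → G a b ≡ true → ¬ DMIrreducible (deleteEdge G a b))

module Submission where

-- Call G covering if every vertex of V⁻ has a neighbour, and expanding if
-- |X| < |Γ(X)| for every X ⊆ V⁺ with ∅ ≠ X ≠ V⁺ (a strict Hall condition).
-- The proof rests on four facts, developed in this order after some finite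
-- counting on Boolean predicates Fin n → Bool:
--   (1) for n ≥ 1, G is DM-irreducible iff it is covering and expanding: then
--       ∅ ⊂ V⁺ is the maximal chain of minimizers of f and V₁ = V, while the
--       blocks V₀ = V and V_∞ = V can never be the whole vertex set;
--   (2) covering + expanding forces all degrees ≥ 2 (expansion at a singleton,
--       resp. at the non-neighbours of a V⁻-vertex), so with 2n edges all
--       degrees are exactly 2;
--   (3) covering + expanding ⇒ connected: the vertices reachable from a root
--       form a set closed under two-step neighbourhoods, and a closed proper
--       set and its complement would have more than n neighbours in total;
--   (4) connected + d-regular ⇒ expanding, by double counting the edges at X.
-- Minimality: deleting an edge leaves a V⁺-vertex of degree 1, contradicting
-- the degree bound of (2) for the smaller graph.

open import Defs
open import Data.Nat using (ℕ; zero; suc; _+_; _*_; _≤_; _<_; z≤n; s≤s; s≤s⁻¹; _<?_; _≤?_)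
open import Data.Nat.Properties hiding (_≟_)
open import Data.Nat.Tactic.RingSolver using (solve-∀)
open import Data.Bool using (Bool; true; false; _∧_; _∨_; not; if_then_else_) renaming (_≟_ to _≟ᵇ_)
open import Data.Bool.Properties using (∧-conicalˡ; ∧-conicalʳ; ∧-inverseˡ; not-injective)
open import Data.Fin using (Fin; zero; suc; _≟_)
import Data.Fin.Properties as Fin
open import Data.Fin.Subset using (Subset; ∣_∣; ⁅_⁆; _⊆_; _⊂_; _─_)
  renaming (⊤ to Full; ⊥ to ∅)
open import Data.Fin.Subset.Properties
  using (∣⊥∣≡0; ∣⊤∣≡n; ∣p∣≤n; ∣⁅x⁆∣≡1; p⊂q⇒∣p∣<∣q∣; p─⊥≡p; ⊆-min; ⊆-max; ∈⊤; ∉⊥; x∈⁅x⁆; x∈⁅y⁆⇒x≡y)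
open import Data.Vec using ([]; _∷_; lookup; tabulate)
open import Data.Vec.Properties
  using (≡-dec; lookup∘tabulate; tabulate∘lookup; tabulate-cong; lookup-replicate; ∷-injective; []=⇒lookup; lookup⇒[]=)
open import Data.List using ([]; _∷_)
open import Data.List.Relation.Unary.All as All using (All; []; _∷_)
open import Data.List.Relation.Unary.Any using (here; there)
import Data.List.Membership.Propositional as List
import Data.Integer as ℤ
import Data.Integer.Properties as ℤP
open import Data.Integer.Tactic.RingSolver renaming (solve-∀ to ℤ-solve-∀)
open import Data.Product using (∃; _×_; _,_; proj₁; proj₂)
import Data.Product as Product
open import Data.Sum using (_⊎_; inj₁; inj₂)
open import Data.Empty using (⊥-elim)
open import Data.Unit using (tt)
open import Function using (_∘_; id)
open import Function.Bundles using (_⇔_; mk⇔; Equivalence)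
open import Relation.Nullary using (¬_; yes; no; contradiction)
open import Relation.Nullary.Decidable using (isYes≗does; dec-true; dec-false)
open import Relation.Binary.PropositionalEquality
open import Relation.Binary.Construct.Closure.ReflexiveTransitive
  using (Star; ε; _◅_; _◅◅_; reverse; fold)

-- Search and counting over Fin n

true≢false : true ≢ false
true≢false ()

search : ∀ {n} (g : Fin n → Bool) → (∃ λ i → g i ≡ true) ⊎ (∀ i → g i ≡ false)
search {zero} g = inj₂ λ ()
search {suc n} g with g zero in e
... | true = inj₁ (zero , e)
... | false with search (g ∘ suc)
...   | inj₁ (i , p) = inj₁ (suc i , p)
...   | inj₂ none = inj₂ λ { zero → e ; (suc i) → none i }

anyFin-intro : ∀ {n} (g : Fin n → Bool) i → g i ≡ true → anyFin g ≡ true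
anyFin-intro g zero e rewrite e = refl
anyFin-intro g (suc i) e with g zero
... | true = refl
... | false = anyFin-intro (g ∘ suc) i e

anyFin-none : ∀ {n} (g : Fin n → Bool) → (∀ i → g i ≡ false) → anyFin g ≡ false
anyFin-none {zero} g none = refl
anyFin-none {suc n} g none rewrite none zero = anyFin-none (g ∘ suc) (none ∘ suc)

anyFin-false : ∀ {n} (g : Fin n → Bool) → anyFin g ≡ false → ∀ i → g i ≡ false
anyFin-false g none i with g i in gi
... | false = refl
... | true = contradiction (trans (sym (anyFin-intro g i gi)) none) λ ()

anyFin-witness : ∀ {n} (g : Fin n → Bool) → anyFin g ≡ true → ∃ λ i → g i ≡ true
anyFin-witness g e with search g
... | inj₁ w = w
... | inj₂ none = contradiction (trans (sym e) (anyFin-none g none)) λ ()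

anyFin-cong : ∀ {n} {g h : Fin n → Bool} → g ≗ h → anyFin g ≡ anyFin h
anyFin-cong {zero} e = refl
anyFin-cong {suc n} {g} {h} e rewrite e zero = cong (h zero ∨_) (anyFin-cong (e ∘ suc))

countFin-cong : ∀ {n} {g h : Fin n → Bool} → g ≗ h → countFin g ≡ countFin h
countFin-cong {zero} e = refl
countFin-cong {suc n} {g} {h} e rewrite e zero =
  cong ((if h zero then 1 else 0) +_) (countFin-cong (e ∘ suc))

countFin-none : ∀ {n} (g : Fin n → Bool) → (∀ i → g i ≡ false) → countFin g ≡ 0
countFin-none {zero} g none = refl
countFin-none {suc n} g none rewrite none zero = countFin-none (g ∘ suc) (none ∘ suc)

countFin-all : ∀ {n} (g : Fin n → Bool) → (∀ i → g i ≡ true) → countFin g ≡ n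
countFin-all {zero} g all = refl
countFin-all {suc n} g all rewrite all zero = cong suc (countFin-all (g ∘ suc) (all ∘ suc))

_⇒ᵇ_ : ∀ {n} → (Fin n → Bool) → (Fin n → Bool) → Set
g ⇒ᵇ h = ∀ i → g i ≡ true → h i ≡ true

countFin-mono : ∀ {n} (g h : Fin n → Bool) → g ⇒ᵇ h → countFin g ≤ countFin h
countFin-mono {zero} g h g⇒h = z≤n
countFin-mono {suc n} g h g⇒h with g zero in eg | h zero in eh
... | true | true = s≤s (countFin-mono _ _ (g⇒h ∘ suc))
... | true | false with () ← trans (sym (g⇒h zero eg)) eh
... | false | true = m≤n⇒m≤1+n (countFin-mono _ _ (g⇒h ∘ suc))
... | false | false = countFin-mono _ _ (g⇒h ∘ suc)

countFin-strict : ∀ {n} (g h : Fin n → Bool) → g ⇒ᵇ h →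
                  ∀ k → g k ≡ false → h k ≡ true → countFin g < countFin h
countFin-strict g h g⇒h zero gk hk rewrite gk | hk = s≤s (countFin-mono _ _ (g⇒h ∘ suc))
countFin-strict g h g⇒h (suc k) gk hk with g zero in eg | h zero in eh
... | true | true = s≤s (countFin-strict _ _ (g⇒h ∘ suc) k gk hk)
... | true | false with () ← trans (sym (g⇒h zero eg)) eh
... | false | true = m≤n⇒m≤1+n (countFin-strict _ _ (g⇒h ∘ suc) k gk hk)
... | false | false = countFin-strict _ _ (g⇒h ∘ suc) k gk hk

countFin-< : ∀ {n} (g : Fin n → Bool) k → g k ≡ false → countFin g < n
countFin-< {n} g k gk =
  subst (countFin g <_) (countFin-all _ λ _ → refl) (countFin-strict g (λ _ → true) (λ _ _ → refl) k gk refl)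

countFin-full : ∀ {n} (g : Fin n → Bool) → n ≤ countFin g → ∀ i → g i ≡ true
countFin-full g full i with g i in gi
... | true = refl
... | false = contradiction full (<⇒≱ (countFin-< g i gi))

countFin-saturated : ∀ {n} (g h : Fin n → Bool) → g ⇒ᵇ h → countFin h ≤ countFin g → h ⇒ᵇ g
countFin-saturated g h g⇒h h≤g i hi with g i in gi
... | true = refl
... | false = contradiction h≤g (<⇒≱ (countFin-strict g h g⇒h i gi hi))

countFin-complement : ∀ {n} (g : Fin n → Bool) → countFin g + countFin (not ∘ g) ≡ n
countFin-complement {zero} g = refl
countFin-complement {suc n} g with g zero
... | true = cong suc (countFin-complement (g ∘ suc))
... | false = trans (+-suc _ _) (cong suc (countFin-complement (g ∘ suc)))

countFin-disjoint : ∀ {n} (g h : Fin n → Bool) → (∀ i → g i ∧ h i ≡ false) →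
                    countFin g + countFin h ≤ n
countFin-disjoint {zero} g h disj = z≤n
countFin-disjoint {suc n} g h disj with g zero | h zero | disj zero
... | true | true | ()
... | true | false | _ = s≤s (countFin-disjoint _ _ (disj ∘ suc))
... | false | true | _ =
  subst (_≤ suc n) (sym (+-suc _ _)) (s≤s (countFin-disjoint _ _ (disj ∘ suc)))
... | false | false | _ = m≤n⇒m≤1+n (countFin-disjoint _ _ (disj ∘ suc))

countFin-remove : ∀ {n} (g g′ : Fin n → Bool) b → g b ≡ true → g′ b ≡ false →
                  (∀ i → i ≢ b → g′ i ≡ g i) → countFin g ≡ suc (countFin g′)
countFin-remove g g′ zero gb g′b same rewrite gb | g′b =
  cong suc (sym (countFin-cong λ i → same (suc i) λ ()))
countFin-remove g g′ (suc b) gb g′b same rewrite same zero (λ ()) with g zero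
... | true = cong suc (countFin-remove _ _ b gb g′b λ i i≢b → same (suc i) (i≢b ∘ Fin.suc-injective))
... | false = countFin-remove _ _ b gb g′b λ i i≢b → same (suc i) (i≢b ∘ Fin.suc-injective)

positive-witness : ∀ {n} (g : Fin n → Bool) → 1 ≤ countFin g → ∃ λ i → g i ≡ true
positive-witness g pos with search g
... | inj₁ w = w
... | inj₂ none = contradiction (countFin-none g none) λ zero≡ → <⇒≱ pos (≤-reflexive zero≡)

deficient-witness : ∀ {n} (g : Fin n → Bool) → countFin g < n → ∃ λ i → g i ≡ false
deficient-witness g lt with search (not ∘ g)
... | inj₁ (k , p) = k , not-injective p
... | inj₂ none = contradiction (countFin-all g (not-injective ∘ none)) (<⇒≢ lt)

-- Sums over Fin n and double counting

sumFin-cong : ∀ {n} {a b : Fin n → ℕ} → a ≗ b → sumFin a ≡ sumFin b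
sumFin-cong {zero} e = refl
sumFin-cong {suc n} e = cong₂ _+_ (e zero) (sumFin-cong (e ∘ suc))

sumFin-+ : ∀ {n} (a b : Fin n → ℕ) → sumFin (λ j → a j + b j) ≡ sumFin a + sumFin b
sumFin-+ {zero} a b = refl
sumFin-+ {suc n} a b rewrite sumFin-+ (a ∘ suc) (b ∘ suc) =
  interchange (a zero) (b zero) (sumFin (a ∘ suc)) (sumFin (b ∘ suc))
  where
  interchange : ∀ x y z w → x + y + (z + w) ≡ x + z + (y + w)
  interchange = solve-∀

sumFin-zero : ∀ n → sumFin {n} (λ _ → 0) ≡ 0
sumFin-zero zero = refl
sumFin-zero (suc n) = sumFin-zero n

sumFin-const : ∀ n k → sumFin {n} (λ _ → k) ≡ n * k
sumFin-const zero k = refl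
sumFin-const (suc n) k = cong (k +_) (sumFin-const n k)

sumFin-swap : ∀ {m n} (M : Fin m → Fin n → ℕ) →
              sumFin (λ i → sumFin (M i)) ≡ sumFin (λ j → sumFin (λ i → M i j))
sumFin-swap {zero} {n} M = sym (sumFin-zero n)
sumFin-swap {suc m} M =
  trans (cong (sumFin (M zero) +_) (sumFin-swap (M ∘ suc)))
        (sym (sumFin-+ (M zero) (λ j → sumFin (λ i → M (suc i) j))))

sumFin-indicator : ∀ {n} (g : Fin n → Bool) k → sumFin (λ i → if g i then k else 0) ≡ k * countFin g
sumFin-indicator {zero} g k = sym (*-zeroʳ k)
sumFin-indicator {suc n} g k with g zero
... | true = trans (cong (k +_) (sumFin-indicator (g ∘ suc) k)) (sym (*-suc k _))
... | false = sumFin-indicator (g ∘ suc) k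

double-count : ∀ {m n} (M : Fin m → Fin n → Bool) →
               sumFin (λ i → countFin (M i)) ≡ sumFin (λ j → countFin (λ i → M i j))
double-count M = begin
  sumFin (λ i → countFin (M i))                            ≡⟨ sumFin-cong (λ i → as-sum (M i)) ⟩
  sumFin (λ i → sumFin (λ j → if M i j then 1 else 0))     ≡⟨ sumFin-swap (λ i j → if M i j then 1 else 0) ⟩
  sumFin (λ j → sumFin (λ i → if M i j then 1 else 0))     ≡⟨ sumFin-cong (λ j → sym (as-sum (λ i → M i j))) ⟩
  sumFin (λ j → countFin (λ i → M i j))                    ∎
  where
  open ≡-Reasoning
  as-sum : ∀ {n} (g : Fin n → Bool) → countFin g ≡ sumFin (λ i → if g i then 1 else 0)
  as-sum {zero} g = refl
  as-sum {suc n} g = cong ((if g zero then 1 else 0) +_) (as-sum (g ∘ suc))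

sumFin-mono : ∀ {n} {a b : Fin n → ℕ} → (∀ i → a i ≤ b i) → sumFin a ≤ sumFin b
sumFin-mono {zero} _ = z≤n
sumFin-mono {suc n} le = +-mono-≤ (le zero) (sumFin-mono (le ∘ suc))

sumFin-tight : ∀ {n} (a b : Fin n → ℕ) → (∀ i → a i ≤ b i) → sumFin b ≤ sumFin a → ∀ i → a i ≡ b i
sumFin-tight {suc n} a b a≤b Σb≤Σa zero =
  ≤-antisym (a≤b zero)
    (+-cancelʳ-≤ _ _ _ (≤-trans Σb≤Σa (+-monoʳ-≤ (a zero) (sumFin-mono (a≤b ∘ suc)))))
sumFin-tight {suc n} a b a≤b Σb≤Σa (suc i) =
  sumFin-tight (a ∘ suc) (b ∘ suc) (a≤b ∘ suc)
    (+-cancelˡ-≤ (a zero) _ _ (≤-trans (+-monoˡ-≤ _ (a≤b zero)) Σb≤Σa)) i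

all-equal : ∀ {n} d (a : Fin n → ℕ) → (∀ i → d ≤ a i) → sumFin a ≤ n * d → ∀ i → a i ≡ d
all-equal {n} d a low total i =
  sym (sumFin-tight (λ _ → d) a low (≤-trans total (≤-reflexive (sym (sumFin-const n d)))) i)

-- Subsets of Fin n as Boolean predicates

lookup-ext : ∀ {n} {X Y : Subset n} → (∀ i → lookup X i ≡ lookup Y i) → X ≡ Y
lookup-ext {X = X} {Y} same = trans (sym (tabulate∘lookup X)) (trans (tabulate-cong same) (tabulate∘lookup Y))

card : ∀ {n} (X : Subset n) → ∣ X ∣ ≡ countFin (lookup X)
card [] = refl
card (true ∷ X) = cong suc (card X)
card (false ∷ X) = card X

card-tabulate : ∀ {n} (P : Fin n → Bool) → ∣ tabulate P ∣ ≡ countFin P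
card-tabulate P = trans (card (tabulate P)) (countFin-cong (lookup∘tabulate P))

∉∅ : ∀ {n} (i : Fin n) → lookup ∅ i ≡ false
∉∅ i = lookup-replicate i false

∈Full : ∀ {n} (i : Fin n) → lookup Full i ≡ true
∈Full i = lookup-replicate i true

⁅⁆-self : ∀ {n} (a : Fin n) → lookup ⁅ a ⁆ a ≡ true
⁅⁆-self a = []=⇒lookup (x∈⁅x⁆ a)

⁅⁆-member : ∀ {n} (a i : Fin n) → lookup ⁅ a ⁆ i ≡ true → i ≡ a
⁅⁆-member a i e = x∈⁅y⁆⇒x≡y a (lookup⇒[]= i ⁅ a ⁆ e)

≢∅⇒member : ∀ {n} {X : Subset n} → X ≢ ∅ → ∃ λ i → lookup X i ≡ true
≢∅⇒member {X = []} X≢∅ = contradiction refl X≢∅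
≢∅⇒member {X = true ∷ X} X≢∅ = zero , refl
≢∅⇒member {X = false ∷ X} X≢∅ =
  let (i , i∈X) = ≢∅⇒member (X≢∅ ∘ cong (false ∷_)) in suc i , i∈X

≢Full⇒nonmember : ∀ {n} {X : Subset n} → X ≢ Full → ∃ λ i → lookup X i ≡ false
≢Full⇒nonmember {X = []} X≢F = contradiction refl X≢F
≢Full⇒nonmember {X = false ∷ X} X≢F = zero , refl
≢Full⇒nonmember {X = true ∷ X} X≢F =
  let (i , i∉X) = ≢Full⇒nonmember (X≢F ∘ cong (true ∷_)) in suc i , i∉X

classify : ∀ {n} (Y : Subset n) → Y ≡ ∅ ⊎ Y ≡ Full ⊎ (Y ≢ ∅ × Y ≢ Full)
classify Y with ≡-dec _≟ᵇ_ Y ∅ | ≡-dec _≟ᵇ_ Y Full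
... | yes Y≡∅ | _ = inj₁ Y≡∅
... | no _ | yes Y≡F = inj₂ (inj₁ Y≡F)
... | no Y≢∅ | no Y≢F = inj₂ (inj₂ (Y≢∅ , Y≢F))

∅≢Full : ∀ {n} → 1 ≤ n → ∅ {n} ≢ Full
∅≢Full {suc n} _ ()

Full⊈∅ : ∀ {n} → 1 ≤ n → ¬ (Full {n} ⊆ ∅)
Full⊈∅ {suc n} _ Full⊆∅ = ∉⊥ (Full⊆∅ (∈⊤ {x = zero}))

Full⊄ : ∀ {n} {Z : Subset n} → ¬ (Full ⊂ Z)
Full⊄ {n} {Z} Full⊂Z = <⇒≱ (p⊂q⇒∣p∣<∣q∣ Full⊂Z) (≤-trans (∣p∣≤n Z) (≤-reflexive (sym (∣⊤∣≡n n))))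

∅⊂Full : ∀ {n} → 1 ≤ n → ∅ {n} ⊂ Full
∅⊂Full {suc n} _ = ⊆-min Full , zero , ∈⊤ , ∉⊥

─≡Full : ∀ {n} (p q : Subset n) → p ─ q ≡ Full → p ≡ Full × q ≡ ∅
─≡Full [] [] _ = refl , refl
─≡Full (true ∷ p) (false ∷ q) e = Product.map (cong (true ∷_)) (cong (false ∷_)) (─≡Full p q (proj₂ (∷-injective e)))
─≡Full (false ∷ p) (false ∷ q) ()
─≡Full (x ∷ p) (true ∷ q) ()

Γᵇ : ∀ {n} → Graph n → (Fin n → Bool) → Fin n → Bool
Γᵇ G P j = anyFin (λ i → P i ∧ G i j)

lookup-Γ : ∀ {n} (G : Graph n) (X : Subset n) j → lookup (Γ G X) j ≡ Γᵇ G (lookup X) j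
lookup-Γ G X j = lookup∘tabulate _ j

card-Γ : ∀ {n} (G : Graph n) (X : Subset n) {P : Fin n → Bool} → lookup X ≗ P →
         ∣ Γ G X ∣ ≡ countFin (Γᵇ G P)
card-Γ G X X≗P = trans (card-tabulate (Γᵇ G (lookup X))) (countFin-cong λ j → anyFin-cong λ i → cong (_∧ G i j) (X≗P i))

Γᵇ-single : ∀ {n} (a : Fin n) (h : Fin n → Bool) → anyFin (λ i → lookup ⁅ a ⁆ i ∧ h i) ≡ h a
Γᵇ-single a h with h a in ha
... | true = anyFin-intro _ a (subst (λ b → b ∧ h a ≡ true) (sym (⁅⁆-self a)) ha)
... | false = anyFin-none _ only-a
  where
  only-a : ∀ i → lookup ⁅ a ⁆ i ∧ h i ≡ false
  only-a i with lookup ⁅ a ⁆ i in s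
  ... | false = refl
  ... | true with refl ← ⁅⁆-member a i s = ha

degree⁺ : ∀ {n} (G : Graph n) a → degree G (inj₁ a) ≡ countFin (G a)
degree⁺ G a = trans (card-Γ G ⁅ a ⁆ (λ _ → refl)) (countFin-cong λ j → Γᵇ-single a (λ i → G i j))

degree⁻ : ∀ {n} (G : Graph n) b → degree G (inj₂ b) ≡ countFin (λ i → G i b)
degree⁻ G b = trans (card-Γ (transpose G) ⁅ b ⁆ (λ _ → refl)) (countFin-cong λ i → Γᵇ-single b (G i))

Covering : ∀ {n} → Graph n → Set
Covering {n} G = ∀ (j : Fin n) → ∃ λ i → G i j ≡ true

Expanding : ∀ {n} → Graph n → Set
Expanding {n} G = ∀ (X : Subset n) → X ≢ ∅ → X ≢ Full → ∣ X ∣ < ∣ Γ G X ∣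

expands : ∀ {n} (G : Graph n) → Expanding G → (P : Fin n → Bool) {i₁ i₀ : Fin n} →
          P i₁ ≡ true → P i₀ ≡ false → countFin P < countFin (Γᵇ G P)
expands G expanding P {i₁} {i₀} p₁ p₀ =
  subst₂ _<_ (card-tabulate P) (card-Γ G (tabulate P) (lookup∘tabulate P))
    (expanding (tabulate P) (λ e → true≢false (trans (at i₁ p₁ e) (∉∅ i₁)))
                            (λ e → true≢false (sym (trans (at i₀ p₀ e) (∈Full i₀)))))
  where
  at : ∀ {Y b} i → P i ≡ b → tabulate P ≡ Y → b ≡ lookup Y i
  at i p e = trans (sym p) (trans (sym (lookup∘tabulate P i)) (cong (λ Z → lookup Z i) e))

expanding-intro : ∀ {n} (G : Graph n) →
                  (∀ (P : Fin n → Bool) {i₁ i₀} → P i₁ ≡ true → P i₀ ≡ false → countFin P < countFin (Γᵇ G P)) →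
                  Expanding G
expanding-intro G expand X X≢∅ X≢F =
  subst₂ _<_ (sym (card X)) (sym (card-Γ G X (λ _ → refl)))
    (expand (lookup X) (proj₂ (≢∅⇒member X≢∅)) (proj₂ (≢Full⇒nonmember X≢F)))

-- The DM-decomposition of a square graph

diff≤diff⇔ : ∀ a b c d → (ℤ.+ a ℤ.- ℤ.+ b ℤ.≤ ℤ.+ c ℤ.- ℤ.+ d) ⇔ (a + d ≤ c + b)
diff≤diff⇔ a b c d = mk⇔ to from
  where
  open ℤ using (ℤ; +_; -_) renaming (_+_ to _+ℤ_; _-_ to _-ℤ_)
  s : ℤ
  s = + b +ℤ + d
  shift₁ : ∀ x y z → (x -ℤ y) +ℤ (y +ℤ z) ≡ x +ℤ z
  shift₁ = ℤ-solve-∀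
  shift₂ : ∀ x y z → (x -ℤ z) +ℤ (y +ℤ z) ≡ x +ℤ y
  shift₂ = ℤ-solve-∀
  to : + a -ℤ + b ℤ.≤ + c -ℤ + d → a + d ≤ c + b
  to le = ℤP.drop‿+≤+ (subst₂ ℤ._≤_ (trans (shift₁ (+ a) (+ b) (+ d)) (sym (ℤP.pos-+ a d)))
                                     (trans (shift₂ (+ c) (+ b) (+ d)) (sym (ℤP.pos-+ c b)))
                                     (ℤP.+-monoˡ-≤ s le))
  unshift₁ : ∀ x y z → (x +ℤ z) -ℤ (y +ℤ z) ≡ x -ℤ y
  unshift₁ = ℤ-solve-∀
  unshift₂ : ∀ x y z → (x +ℤ y) -ℤ (y +ℤ z) ≡ x -ℤ z
  unshift₂ = ℤ-solve-∀
  from : a + d ≤ c + b → + a -ℤ + b ℤ.≤ + c -ℤ + d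
  from le = subst₂ ℤ._≤_ (trans (cong (_-ℤ s) (ℤP.pos-+ a d)) (unshift₁ (+ a) (+ b) (+ d)))
                         (trans (cong (_-ℤ s) (ℤP.pos-+ c b)) (unshift₂ (+ c) (+ b) (+ d)))
                         (ℤP.+-monoˡ-≤ (- s) (ℤ.+≤+ le))

⊆-last : ∀ {n} (X : Subset n) Xs → StrictlyIncreasing X Xs → ∀ {Y} → Y List.∈ (X ∷ Xs) → Y ⊆ lastOf X Xs
⊆-last X [] _ (here refl) = id
⊆-last X (Z ∷ Zs) (X⊂Z , increasing) (here refl) = ⊆-last Z Zs increasing (here refl) ∘ proj₁ X⊂Z
⊆-last X (Z ∷ Zs) (_ , increasing) (there Y∈Zs) = ⊆-last Z Zs increasing Y∈Zs

All-last : ∀ {n} {P : Subset n → Set} X Xs → All P (X ∷ Xs) → P (lastOf X Xs)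
All-last X [] (px ∷ []) = px
All-last X (Z ∷ Zs) (_ ∷ pZs) = All-last Z Zs pZs

module _ {n : ℕ} (G : Graph n) where

  Γ-∅ : Γ G ∅ ≡ ∅
  Γ-∅ = lookup-ext λ j → trans (lookup-Γ G ∅ j)
          (trans (anyFin-none _ λ i → cong (_∧ G i j) (∉∅ i)) (sym (∉∅ j)))

  f-∅ : f G ∅ ≡ ℤ.+ 0 ℤ.- ℤ.+ 0
  f-∅ = cong₂ (λ u v → ℤ.+ u ℤ.- ℤ.+ v) (trans (cong ∣_∣ Γ-∅) (∣⊥∣≡0 n)) (∣⊥∣≡0 n)

  hall⇒f∅≤f : ∀ Y → ∣ Y ∣ ≤ ∣ Γ G Y ∣ → f G ∅ ℤ.≤ f G Y
  hall⇒f∅≤f Y hall = subst (ℤ._≤ f G Y) (sym f-∅)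
    (Equivalence.from (diff≤diff⇔ 0 0 _ _) (≤-trans hall (≤-reflexive (sym (+-identityʳ _)))))

  f≤f∅⇔ : ∀ Y → (f G Y ℤ.≤ f G ∅) ⇔ (∣ Γ G Y ∣ ≤ ∣ Y ∣)
  f≤f∅⇔ Y = mk⇔
    (λ le → subst (_≤ ∣ Y ∣) (+-identityʳ _) (Equivalence.to (diff≤diff⇔ _ _ 0 0) (subst (f G Y ℤ.≤_) f-∅ le)))
    (λ le → subst (f G Y ℤ.≤_) (sym f-∅) (Equivalence.from (diff≤diff⇔ _ _ 0 0) (subst (_≤ ∣ Y ∣) (sym (+-identityʳ _)) le)))

  minimizer-below : ∀ X Y → Minimizer G X → f G Y ℤ.≤ f G X → Minimizer G Y
  minimizer-below X Y minX le Z = ℤP.≤-trans le (minX Z)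

  Γ-Full : Covering G → Γ G Full ≡ Full
  Γ-Full covering = lookup-ext λ j →
    let (i , e) = covering j in
    trans (lookup-Γ G Full j)
      (trans (anyFin-intro _ i (subst (λ b → b ∧ G i j ≡ true) (sym (∈Full i)) e)) (sym (∈Full j)))

  covering-from-Γ : Γ G Full ≡ Full → Covering G
  covering-from-Γ e j =
    let (i , p) = anyFin-witness _ (trans (sym (lookup-Γ G Full j)) (trans (cong (λ Z → lookup Z j) e) (∈Full j)))
    in i , ∧-conicalʳ _ _ p

  -- V₀ = V is impossible: X₀ would be Full, which has no strict successor in
  -- the chain, while ∅ (with f(∅) = 0 = f(Full)) would be a further minimizer.
  V₀≢V : 1 ≤ n → ∀ {X₀ Xs} → MaximalMinimizerChain G X₀ Xs → V₀ G X₀ Xs ≢ (Full , Full)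
  V₀≢V one {X₀} {[]} (_ , minX₀ ∷ [] , maximal) e with maximal ∅ min∅ (inj₁ (⊆-min X₀) ∷ [])
    where
    min∅ : Minimizer G ∅
    min∅ = minimizer-below X₀ ∅ minX₀ (hall⇒f∅≤f X₀ (≤-reflexive (cong ∣_∣ (trans (cong proj₁ e) (sym (cong proj₂ e))))))
  ... | here ∅≡X₀ = ∅≢Full one (trans ∅≡X₀ (cong proj₁ e))
  V₀≢V one {X₀} {Z ∷ _} ((X₀⊂Z , _) , _) e = Full⊄ (subst (_⊂ Z) (cong proj₁ e) X₀⊂Z)

  -- V_∞ = V is impossible: the last member of the chain would be ∅, and then
  -- Full (with f(Full) ≤ 0 = f(∅)) would be a further minimizer above it.
  V∞≢V : 1 ≤ n → ∀ {X₀ Xs} → MaximalMinimizerChain G X₀ Xs → V∞ G X₀ Xs ≢ (Full , Full)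
  V∞≢V one {X₀} {Xs} (increasing , minimizers , maximal) e =
    Full⊈∅ one (subst (Full ⊆_) last≡∅ (⊆-last X₀ Xs increasing (maximal Full minFull comparable)))
    where
    last≡∅ : lastOf X₀ Xs ≡ ∅
    last≡∅ = proj₂ (─≡Full Full (lastOf X₀ Xs) (cong proj₁ e))
    minFull : Minimizer G Full
    minFull = minimizer-below ∅ Full (subst (Minimizer G) last≡∅ (All-last X₀ Xs minimizers))
                (Equivalence.from (f≤f∅⇔ Full) (≤-trans (∣p∣≤n (Γ G Full)) (≤-reflexive (sym (∣⊤∣≡n n)))))
    comparable : All (λ X → Full ⊆ X ⊎ X ⊆ Full) (X₀ ∷ Xs)
    comparable = All.tabulate λ {X} _ → inj₂ (⊆-max X)

  -- V₁ = V forces the chain ∅ ⊂ Full and Γ(Full) = Full; a set Y other than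
  -- ∅ and Full that fails to expand would have f(Y) ≤ f(∅) and extend the chain.
  V₁≡V⇒ : ∀ {X₀ Xs} → MaximalMinimizerChain G X₀ Xs → V₁IsAll G X₀ Xs → Covering G × Expanding G
  V₁≡V⇒ {X₀} {X₁ ∷ Z ∷ _} ((_ , X₁⊂Z , _) , _) (V₁⁺ , _) =
    ⊥-elim (Full⊄ (subst (_⊂ Z) (proj₁ (─≡Full X₁ X₀ V₁⁺)) X₁⊂Z))
  V₁≡V⇒ {X₀} {X₁ ∷ []} (_ , min₀ ∷ _ , maximal) (V₁⁺ , V₁⁻) with ─≡Full X₁ X₀ V₁⁺
  ... | refl , refl = covering-from-Γ (proj₁ (─≡Full _ _ V₁⁻)) , expanding
    where
    expanding : Expanding G
    expanding Y Y≢∅ Y≢F with ∣ Y ∣ <? ∣ Γ G Y ∣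
    ... | yes grows = grows
    ... | no ¬grows with maximal Y (minimizer-below ∅ Y min₀ (Equivalence.from (f≤f∅⇔ Y) (≮⇒≥ ¬grows)))
                                 (inj₂ (⊆-min Y) ∷ inj₁ (⊆-max Y) ∷ [])
    ...   | here Y≡∅ = contradiction Y≡∅ Y≢∅
    ...   | there (here Y≡F) = contradiction Y≡F Y≢F

  DMIrreducible⇔ : 1 ≤ n → DMIrreducible G ⇔ (Covering G × Expanding G)
  DMIrreducible⇔ one = mk⇔ to from
    where
    to : DMIrreducible G → Covering G × Expanding G
    to (_ , _ , chain , inj₁ V₀≡V) = ⊥-elim (V₀≢V one chain V₀≡V)
    to (_ , _ , chain , inj₂ (inj₁ V₁≡V)) = V₁≡V⇒ chain V₁≡V
    to (_ , _ , chain , inj₂ (inj₂ V∞≡V)) = ⊥-elim (V∞≢V one chain V∞≡V)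

    -- ∅ ⊂ Full is a maximal chain of minimizers: f ≥ 0 = f(∅) = f(Full),
    -- and f > 0 on every other set; its block V₁ is all of V.
    from : Covering G × Expanding G → DMIrreducible G
    from (covering , expanding) =
      ∅ , Full ∷ [] , ((∅⊂Full one , tt) , min∅ ∷ minFull ∷ [] , maximal) ,
      inj₂ (inj₁ (p─⊥≡p Full , trans (cong₂ _─_ ΓFull Γ-∅) (p─⊥≡p Full)))
      where
      ΓFull : Γ G Full ≡ Full
      ΓFull = Γ-Full covering
      min∅ : Minimizer G ∅
      min∅ Y with classify Y
      ... | inj₁ refl = ℤP.≤-refl
      ... | inj₂ (inj₁ refl) = hall⇒f∅≤f Full (≤-reflexive (cong ∣_∣ (sym ΓFull)))
      ... | inj₂ (inj₂ (Y≢∅ , Y≢F)) = hall⇒f∅≤f Y (<⇒≤ (expanding Y Y≢∅ Y≢F))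
      minFull : Minimizer G Full
      minFull = minimizer-below ∅ Full min∅ (Equivalence.from (f≤f∅⇔ Full) (≤-reflexive (cong ∣_∣ ΓFull)))
      maximal : ∀ Y → Minimizer G Y → All (λ X → Y ⊆ X ⊎ X ⊆ Y) (∅ ∷ Full ∷ []) → Y List.∈ (∅ ∷ Full ∷ [])
      maximal Y minY _ with classify Y
      ... | inj₁ Y≡∅ = here Y≡∅
      ... | inj₂ (inj₁ Y≡F) = there (here Y≡F)
      ... | inj₂ (inj₂ (Y≢∅ , Y≢F)) =
        contradiction (Equivalence.to (f≤f∅⇔ Y) (minY ∅)) (<⇒≱ (expanding Y Y≢∅ Y≢F))

-- Degrees in covering expanding graphs

module _ {n : ℕ} (G : Graph n) (two : 2 ≤ n) where

  -- Expansion at a singleton {a}: every V⁺-vertex has at least two neighbours.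
  degree⁺≥2 : Expanding G → ∀ a → 2 ≤ countFin (G a)
  degree⁺≥2 expanding a = subst₂ _<_ (∣⁅x⁆∣≡1 a) (degree⁺ G a) (expanding ⁅ a ⁆ ⁅a⁆≢∅ ⁅a⁆≢Full)
    where
    ⁅a⁆≢∅ : ⁅ a ⁆ ≢ ∅
    ⁅a⁆≢∅ e = contradiction (trans (sym (∣⁅x⁆∣≡1 a)) (trans (cong ∣_∣ e) (∣⊥∣≡0 n))) λ ()
    ⁅a⁆≢Full : ⁅ a ⁆ ≢ Full
    ⁅a⁆≢Full e = 1+n≰n (subst (2 ≤_) (trans (sym (∣⊤∣≡n n)) (trans (cong ∣_∣ (sym e)) (∣⁅x⁆∣≡1 a))) two)

  -- Expansion at the non-neighbours P of b: if b had at most one neighbour,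
  -- then n - 1 ≤ |P| < |Γ(P)| ≤ n - 1, since b ∉ Γ(P).
  degree⁻≥2 : Covering G → Expanding G → ∀ b → 2 ≤ countFin (λ i → G i b)
  degree⁻≥2 covering expanding b with 2 ≤? countFin (λ i → G i b)
  ... | yes enough = enough
  ... | no few = ⊥-elim (<-irrefl refl (begin-strict
        n                                ≡⟨ sym (countFin-complement column) ⟩
        countFin column + countFin P     ≤⟨ +-monoˡ-≤ (countFin P) at-most-one ⟩
        suc (countFin P)                 ≤⟨ expands G expanding P (cong not (proj₂ non-neighbour)) (cong not (proj₂ neighbour)) ⟩
        countFin (Γᵇ G P)                <⟨ countFin-< (Γᵇ G P) b b-missed ⟩
        n                                ∎))
    where
    open ≤-Reasoning
    column : Fin n → Bool
    column i = G i b
    P : Fin n → Bool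
    P = not ∘ column
    at-most-one : countFin column ≤ 1
    at-most-one = s≤s⁻¹ (≰⇒> few)
    non-neighbour : ∃ λ i → column i ≡ false
    non-neighbour = deficient-witness column (≤-trans (s≤s at-most-one) two)
    neighbour : ∃ λ i → column i ≡ true
    neighbour = covering b
    b-missed : Γᵇ G P b ≡ false
    b-missed = anyFin-none _ λ i → ∧-inverseˡ (G i b)

  two-regular : Covering G → Expanding G → edgeCount G ≡ 2 * n → ∀ v → degree G v ≡ 2
  two-regular covering expanding edges (inj₁ a) =
    trans (degree⁺ G a) (all-equal 2 (countFin ∘ G) (degree⁺≥2 expanding) rows a)
    where
    rows : edgeCount G ≤ n * 2
    rows = ≤-reflexive (trans edges (*-comm 2 n))
  two-regular covering expanding edges (inj₂ b) =
    trans (degree⁻ G b) (all-equal 2 (λ j → countFin (λ i → G i j)) (degree⁻≥2 covering expanding) columns b)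
    where
    columns : sumFin (λ j → countFin (λ i → G i j)) ≤ n * 2
    columns = ≤-reflexive (trans (sym (double-count G)) (trans edges (*-comm 2 n)))

-- Covering expanding graphs are connected

Adj-sym : ∀ {n} {G : Graph n} {u v} → Adj G u v → Adj G v u
Adj-sym (plus→minus e) = minus→plus e
Adj-sym (minus→plus e) = plus→minus e

module _ {n : ℕ} (G : Graph n) (covering : Covering G) (expanding : Expanding G) (r : Fin n) where

  Reached : (Fin n → Bool) → Set
  Reached R = ∀ i → R i ≡ true → Star (Adj G) (inj₁ r) (inj₁ i)

  step₂ : (Fin n → Bool) → Fin n → Bool
  step₂ R i = anyFin (λ j → Γᵇ G R j ∧ G i j)

  step₂-reached : ∀ {R} → Reached R → Reached (λ i → R i ∨ step₂ R i)
  step₂-reached {R} reached i e with R i in Ri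
  ... | true = reached i Ri
  ... | false =
    let (j , Rj-i) = anyFin-witness (λ j → Γᵇ G R j ∧ G i j) e
        (k , Rk-j) = anyFin-witness (λ k → R k ∧ G k j) (∧-conicalˡ _ (G i j) Rj-i)
    in reached k (∧-conicalˡ (R k) _ Rk-j) ◅◅ plus→minus (∧-conicalʳ (R k) _ Rk-j)
         ◅ minus→plus (∧-conicalʳ (Γᵇ G R j) _ Rj-i) ◅ ε

  -- A set containing r and closed under two-step neighbours is everything:
  -- otherwise it and its complement would have disjoint neighbourhoods,
  -- each strictly larger than the set itself, so more than n in total.
  closed⇒everything : ∀ R → R r ≡ true → (∀ k → step₂ R k ≡ true → R k ≡ true) → ∀ i → R i ≡ true
  closed⇒everything R Rr closed i with R i in Ri
  ... | true = refl
  ... | false = ⊥-elim (<-irrefl refl (begin-strict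
        n                                                ≡⟨ sym (countFin-complement R) ⟩
        countFin R + countFin (not ∘ R)                  <⟨ +-mono-< (expands G expanding R Rr Ri)
                                                                      (expands G expanding (not ∘ R) (cong not Ri) (cong not Rr)) ⟩
        countFin (Γᵇ G R) + countFin (Γᵇ G (not ∘ R))    ≤⟨ countFin-disjoint _ _ disjoint ⟩
        n                                                ∎))
    where
    open ≤-Reasoning
    disjoint : ∀ j → Γᵇ G R j ∧ Γᵇ G (not ∘ R) j ≡ false
    disjoint j with Γᵇ G R j in inR | Γᵇ G (not ∘ R) j in inR̅
    ... | false | _ = refl
    ... | true | false = refl
    ... | true | true =
      let (k , p) = anyFin-witness _ inR̅
          Rk = closed k (anyFin-intro _ j (subst (λ b → b ∧ G k j ≡ true) (sym inR) (∧-conicalʳ _ _ p)))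
      in contradiction (trans (sym (∧-conicalˡ _ _ p)) (cong not Rk)) λ ()

  -- Grow a reached set by two-step neighbours until it is closed; every
  -- round adds a point, so the fuel n (together with |R|) suffices.
  grow : ∀ fuel R → Reached R → R r ≡ true → n ≤ fuel + countFin R → ∀ i → Star (Adj G) (inj₁ r) (inj₁ i)
  grow zero R reached Rr large i = reached i (countFin-full R large i)
  grow (suc fuel) R reached Rr large i with search (λ k → step₂ R k ∧ not (R k))
  ... | inj₁ (k , new) = grow fuel R′ (step₂-reached reached) (cong (_∨ step₂ R r) Rr) larger i
    where
    R′ : Fin n → Bool
    R′ x = R x ∨ step₂ R x
    Rk : R k ≡ false
    Rk = not-injective (∧-conicalʳ _ _ new)
    gained : countFin R < countFin R′
    gained = countFin-strict R R′ (λ x Rx → cong (_∨ step₂ R x) Rx) k Rk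
               (trans (cong (_∨ step₂ R k) Rk) (∧-conicalˡ _ _ new))
    larger : n ≤ fuel + countFin R′
    larger = ≤-trans large (subst (_≤ fuel + countFin R′) (+-suc fuel (countFin R)) (+-monoʳ-≤ fuel gained))
  ... | inj₂ none = reached i (closed⇒everything R Rr closed i)
    where
    closed : ∀ k → step₂ R k ≡ true → R k ≡ true
    closed k new with R k in Rk
    ... | true = refl
    ... | false with () ← trans (sym (none k)) (cong₂ _∧_ new (cong not Rk))

  reachable : ∀ v → Star (Adj G) (inj₁ r) v
  reachable (inj₁ i) = grow n (lookup ⁅ r ⁆) start (⁅⁆-self r) (m≤m+n n _) i
    where
    start : Reached (lookup ⁅ r ⁆)
    start i e with refl ← ⁅⁆-member r i e = ε
  reachable (inj₂ j) = let (i , e) = covering j in reachable (inj₁ i) ◅◅ plus→minus e ◅ ε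

expanding⇒connected : ∀ {n} (G : Graph n) → Covering G → Expanding G → Connected G
expanding⇒connected G covering expanding u v =
  reverse Adj-sym (reachable G covering expanding (root u) u) ◅◅ reachable G covering expanding (root u) v
  where
  root : Vertex _ → Fin _
  root (inj₁ i) = i
  root (inj₂ j) = proj₁ (covering j)

-- Connected regular graphs are expanding

module _ {n : ℕ} (G : Graph n) (d : ℕ)
         (rows : ∀ i → countFin (G i) ≡ d) (columns : ∀ j → countFin (λ i → G i j) ≡ d) where

  edges-at : ∀ (P : Fin n → Bool) → sumFin (λ j → countFin (λ i → P i ∧ G i j)) ≡ d * countFin P
  edges-at P = begin
    sumFin (λ j → countFin (λ i → P i ∧ G i j))   ≡⟨ sym (double-count (λ i j → P i ∧ G i j)) ⟩
    sumFin (λ i → countFin (λ j → P i ∧ G i j))   ≡⟨ sumFin-cong row-in-P ⟩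
    sumFin (λ i → if P i then d else 0)           ≡⟨ sumFin-indicator P d ⟩
    d * countFin P                                ∎
    where
    open ≡-Reasoning
    row-in-P : ∀ i → countFin (λ j → P i ∧ G i j) ≡ (if P i then d else 0)
    row-in-P i with P i
    ... | true = rows i
    ... | false = countFin-none (λ j → false ∧ G i j) λ _ → refl

  -- If |Γ(P)| ≤ |P|, the count above is tight: each j ∈ Γ(P) has all its d
  -- neighbours in P, i.e. P ∪ Γ(P) is closed under adjacency.
  non-expanding⇒closed : ∀ (P : Fin n → Bool) → countFin (Γᵇ G P) ≤ countFin P →
                         ∀ j → Γᵇ G P j ≡ true → ∀ i → G i j ≡ true → P i ≡ true
  non-expanding⇒closed P few j inΓ i Gij =
    ∧-conicalˡ (P i) _ (countFin-saturated (λ i → P i ∧ G i j) (λ i → G i j) (λ i → ∧-conicalʳ (P i) _)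
                          (≤-reflexive saturated) i Gij)
    where
    at : Fin n → ℕ
    at j = countFin (λ i → P i ∧ G i j)
    bound : Fin n → ℕ
    bound j = if Γᵇ G P j then d else 0
    at≤bound : ∀ j → at j ≤ bound j
    at≤bound j with Γᵇ G P j in inΓ
    ... | true = subst (at j ≤_) (columns j) (countFin-mono _ _ λ i → ∧-conicalʳ (P i) _)
    ... | false = ≤-reflexive (countFin-none _ (anyFin-false (λ i → P i ∧ G i j) inΓ))
    Σbound≤Σat : sumFin bound ≤ sumFin at
    Σbound≤Σat = subst₂ _≤_ (sym (sumFin-indicator (Γᵇ G P) d)) (sym (edges-at P)) (*-monoʳ-≤ d few)
    saturated : countFin (λ i → G i j) ≡ countFin (λ i → P i ∧ G i j)
    saturated = trans (columns j) (trans (cong (λ b → if b then d else 0) (sym inΓ))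
                  (sym (sumFin-tight at bound at≤bound Σbound≤Σat j)))

regular-connected⇒expanding : ∀ {n} (G : Graph n) d → (∀ v → degree G v ≡ d) → Connected G → Expanding G
regular-connected⇒expanding G d regular connected = expanding-intro G expand
  where
  rows : ∀ i → countFin (G i) ≡ d
  rows i = trans (sym (degree⁺ G i)) (regular (inj₁ i))
  columns : ∀ j → countFin (λ i → G i j) ≡ d
  columns j = trans (sym (degree⁻ G j)) (regular (inj₂ j))
  -- A non-expanding P would make P ∪ Γ(P) closed; the walk from i₁ to i₀ would stay inside.
  expand : ∀ P {i₁ i₀} → P i₁ ≡ true → P i₀ ≡ false → countFin P < countFin (Γᵇ G P)
  expand P {i₁} {i₀} Pi₁ Pi₀ with countFin P <? countFin (Γᵇ G P)
  ... | yes grows = grows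
  ... | no ¬grows = contradiction (trans (sym (along (connected (inj₁ i₁) (inj₁ i₀)) Pi₁)) Pi₀) λ ()
    where
    Inside : Vertex _ → Set
    Inside (inj₁ i) = P i ≡ true
    Inside (inj₂ j) = Γᵇ G P j ≡ true
    step : ∀ {u v} → Adj G u v → Inside u → Inside v
    step (plus→minus {i} {j} Gij) Pi = anyFin-intro _ i (subst (λ b → b ∧ G i j ≡ true) (sym Pi) Gij)
    step (minus→plus {i} {j} Gij) inΓ =
      non-expanding⇒closed G d rows columns P (≮⇒≥ ¬grows) j inΓ i Gij
    along : ∀ {u v} → Star (Adj G) u v → Inside u → Inside v
    along = fold (λ u v → Inside u → Inside v) (λ uv inside → inside ∘ step uv) id

-- Minimality and the theorem

deleteEdge-row : ∀ {n} (G : Graph n) a b → G a b ≡ true → countFin (G a) ≡ suc (countFin (deleteEdge G a b a))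
deleteEdge-row G a b Gab = countFin-remove (G a) (deleteEdge G a b a) b Gab removed kept
  where
  removed : deleteEdge G a b a b ≡ false
  removed rewrite isYes≗does (a ≟ a) | dec-true (a ≟ a) refl
                | isYes≗does (b ≟ b) | dec-true (b ≟ b) refl = refl
  kept : ∀ j → j ≢ b → deleteEdge G a b a j ≡ G a j
  kept j j≢b rewrite isYes≗does (a ≟ a) | dec-true (a ≟ a) refl
                   | isYes≗does (j ≟ b) | dec-false (j ≟ b) j≢b = refl

-- In a 2-regular graph no edge can be deleted: the V⁺-endpoint would keep a
-- single neighbour, while DM-irreducible graphs have all V⁺-degrees ≥ 2.
deletion-breaks : ∀ {n} (G : Graph n) → 2 ≤ n → (∀ v → degree G v ≡ 2) →
                  ∀ a b → G a b ≡ true → ¬ DMIrreducible (deleteEdge G a b)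
deletion-breaks G two regular a b Gab irreducible =
  1+n≰n (subst (2 ≤_) single-neighbour (degree⁺≥2 G′ two expanding′ a))
  where
  G′ : Graph _
  G′ = deleteEdge G a b
  expanding′ : Expanding G′
  expanding′ = proj₂ (Equivalence.to (DMIrreducible⇔ G′ (≤-trans (s≤s z≤n) two)) irreducible)
  single-neighbour : countFin (G′ a) ≡ 1
  single-neighbour = suc-injective (trans (sym (deleteEdge-row G a b Gab)) (trans (sym (degree⁺ G a)) (regular (inj₁ a))))

regular⇒covering : ∀ {n} (G : Graph n) d → (∀ v → degree G v ≡ suc d) → Covering G
regular⇒covering G d regular j =
  positive-witness (λ i → G i j) (subst (1 ≤_) (trans (sym (regular (inj₂ j))) (degree⁻ G j)) (s≤s z≤n))

lemma4p5 : (n : ℕ) → 2 ≤ n → (G : Graph n) → edgeCount G ≡ 2 * n →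
    (MinimallyDMIrreducible G ⇔ (Connected G × (∀ v → degree G v ≡ 2)))
lemma4p5 n two G edges = mk⇔ to from
  where
  one : 1 ≤ n
  one = ≤-trans (s≤s z≤n) two

  to : MinimallyDMIrreducible G → Connected G × (∀ v → degree G v ≡ 2)
  to (irreducible , _) =
    let (covering , expanding) = Equivalence.to (DMIrreducible⇔ G one) irreducible
    in expanding⇒connected G covering expanding , two-regular G two covering expanding edges

  from : Connected G × (∀ v → degree G v ≡ 2) → MinimallyDMIrreducible G
  from (connected , regular) =
    Equivalence.from (DMIrreducible⇔ G one)
      (regular⇒covering G 1 regular , regular-connected⇒expanding G 2 regular connected)
    , deletion-breaks G two regular
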